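{- Let $S$ be a $t$-conorm, $T$ a $t$-norm and $N$ a strong fuzzy negation such that $N(T(x,y))=S(N(x),N(y))$ for all $x,y\in[0,1]$. Let $I_{S,N,T}(x,y)=S(N(T(x,N(y))),N(x))$. Then $I_{S,N,T}(x,I_{S,N,T}(y,z))=I_{S,N,T}(y,I_{S,N,T}(x,z))$ for all $x,y,z\in[0,1]$.
   Context: A $t$-norm is a function $T:[0,1]^2\to[0,1]$ that is commutative, associative, non-decreasing in each argument and satisfies $T(x,1)=x$. A $t$-conorm is a function $S:[0,1]^2\to[0,1]$ that is commutative, associative, non-decreasing in each argument and satisfies $S(x,0)=x$. A fuzzy negation is a non-increasing $N:[0,1]\to[0,1]$ with $N(0)=1$, $N(1)=0$; it is strong if $N(N(x))=x$ for all $x$. -}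

module Defs where

open import Level using (0ℓ)
open import Data.Product using (Σ; ∃; _×_; _,_)
open import Relation.Nullary using (¬_)
open import Relation.Binary.PropositionalEquality using (_≡_)
open import Relation.Binary.Structures using (IsTotalOrder)
open import Algebra.Structures using (IsCommutativeRing)

-- We axiomatise them as a
-- complete ordered field (any model of these axioms is isomorphic to ℝ),
-- and state everything relative to an arbitrary such model.
record RealField : Set₁ where
  infixl 6 _+_
  infixl 7 _*_
  infix 4 _≤_
  field
    Carrier : Set
    _+_ _*_ : Carrier → Carrier → Carrier
    -_      : Carrier → Carrier
    0r 1r   : Carrier
    _≤_     : Carrier → Carrier → Set
    isCommutativeRing : IsCommutativeRing _≡_ _+_ _*_ -_ 0r 1r
    0≢1     : ¬ (0r ≡ 1r)
    inverse : ∀ x → ¬ (x ≡ 0r) → Σ Carrier (λ y → x * y ≡ 1r)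
    isTotalOrder : IsTotalOrder _≡_ _≤_
    +-monoˡ-≤ : ∀ {x y} z → x ≤ y → x + z ≤ y + z
    0≤1       : 0r ≤ 1r   -- (derivable; included for convenience)
    *-nonneg  : ∀ {x y} → 0r ≤ x → 0r ≤ y → 0r ≤ x * y
    sup : (P : Carrier → Set) → ∃ P → (∃ λ b → ∀ x → P x → x ≤ b) →
          ∃ λ s → (∀ x → P x → x ≤ s) × (∀ b → (∀ x → P x → x ≤ b) → s ≤ b)

module UnitInterval (R : RealField) where
  open RealField R

  -- the unit interval [0,1]; the bound proofs are irrelevant, so two
  -- elements are equal iff their underlying reals are equal
  record I : Set where
    constructor ⟨_⟩
    field
      val : Carrier
      .lo : 0r ≤ val
      .hi : val ≤ 1r
  open I public

  infix 4 _≤I_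
  _≤I_ : I → I → Set
  x ≤I y = val x ≤ val y

  0I : I
  0I = record { val = 0r ; lo = IsTotalOrder.refl isTotalOrder ; hi = 0≤1 }

  1I : I
  1I = record { val = 1r ; lo = 0≤1 ; hi = IsTotalOrder.refl isTotalOrder }

  record IsTNorm (T : I → I → I) : Set where
    field
      comm     : ∀ x y → T x y ≡ T y x
      assoc    : ∀ x y z → T (T x y) z ≡ T x (T y z)
      mono     : ∀ {x x′ y y′} → x ≤I x′ → y ≤I y′ → T x y ≤I T x′ y′
      identity : ∀ x → T x 1I ≡ x

  record IsTConorm (S : I → I → I) : Set where
    field
      comm     : ∀ x y → S x y ≡ S y x
      assoc    : ∀ x y z → S (S x y) z ≡ S x (S y z)
      mono     : ∀ {x x′ y y′} → x ≤I x′ → y ≤I y′ → S x y ≤I S x′ y′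
      identity : ∀ x → S x 0I ≡ x

  record IsFuzzyNegation (N : I → I) : Set where
    field
      antitone : ∀ {x y} → x ≤I y → N y ≤I N x
      N0       : N 0I ≡ 1I
      N1       : N 1I ≡ 0I

  record IsStrongNegation (N : I → I) : Set where
    field
      isFuzzyNegation : IsFuzzyNegation N
      involutive      : ∀ x → N (N x) ≡ x

  I[_,_,_] : (I → I → I) → (I → I) → (I → I → I) → I → I → I
  I[ S , N , T ] x y = S (N (T x (N y))) (N x)

{-# OPTIONS --safe #-}
module Submission where

open import Defs
open import Level using (0ℓ)
open import Algebra.Bundles using (CommutativeSemigroup)
open import Algebra.Structures using (IsCommutativeSemigroup)
import Algebra.Properties.CommutativeSemigroup as CommutativeSemigroupProperties
open import Relation.Binary.PropositionalEquality
  using (_≡_; cong; cong₂; isEquivalence)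
open Relation.Binary.PropositionalEquality.≡-Reasoning

-- By De Morgan and involutivity, I_{S,N,T}(x,y) = S(S(N x, N x), y) is a left
-- translation of the commutative semigroup ([0,1], S), and left translations of
-- a commutative semigroup commute.

module _ (R : RealField) where
  open UnitInterval R

  IsTConorm⇒IsCommutativeSemigroup : ∀ {S} → IsTConorm S → IsCommutativeSemigroup _≡_ S
  IsTConorm⇒IsCommutativeSemigroup isTConorm = record
    { isSemigroup = record
      { isMagma = record { isEquivalence = isEquivalence ; ∙-cong = cong₂ _ }
      ; assoc   = IsTConorm.assoc isTConorm
      }
    ; comm = IsTConorm.comm isTConorm
    }

  tConormCommutativeSemigroup : ∀ {S} → IsTConorm S → CommutativeSemigroup 0ℓ 0ℓ
  tConormCommutativeSemigroup isTConorm =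
    record { isCommutativeSemigroup = IsTConorm⇒IsCommutativeSemigroup isTConorm }

  module _ {S T : I → I → I} {N : I → I}
           (isTConorm : IsTConorm S) (isStrongNegation : IsStrongNegation N)
           (deMorgan : ∀ x y → N (T x y) ≡ S (N x) (N y)) where

    open CommutativeSemigroupProperties (tConormCommutativeSemigroup isTConorm)

    I[S,N,T]≡translation : ∀ x y → I[ S , N , T ] x y ≡ S (S (N x) (N x)) y
    I[S,N,T]≡translation x y = begin
      S (N (T x (N y))) (N x)     ≡⟨ cong (λ t → S t (N x)) (deMorgan x (N y)) ⟩
      S (S (N x) (N (N y))) (N x) ≡⟨ cong (λ t → S (S (N x) t) (N x)) (IsStrongNegation.involutive isStrongNegation y) ⟩
      S (S (N x) y) (N x)         ≡⟨ xy∙z≈xz∙y (N x) y (N x) ⟩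
      S (S (N x) (N x)) y         ∎

    I[S,N,T]-exchange : ∀ x y z → I[ S , N , T ] x (I[ S , N , T ] y z) ≡ I[ S , N , T ] y (I[ S , N , T ] x z)
    I[S,N,T]-exchange x y z = begin
      I[ S , N , T ] x (I[ S , N , T ] y z) ≡⟨ I[S,N,T]≡translation x _ ⟩
      S (S (N x) (N x)) (I[ S , N , T ] y z) ≡⟨ cong (S _) (I[S,N,T]≡translation y z) ⟩
      S (S (N x) (N x)) (S (S (N y) (N y)) z) ≡⟨ x∙yz≈y∙xz _ _ z ⟩
      S (S (N y) (N y)) (S (S (N x) (N x)) z) ≡⟨ cong (S _) (I[S,N,T]≡translation x z) ⟨
      S (S (N y) (N y)) (I[ S , N , T ] x z) ≡⟨ I[S,N,T]≡translation y _ ⟨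
      I[ S , N , T ] y (I[ S , N , T ] x z) ∎

proposition3p4 : (R : RealField) → let open UnitInterval R in
    (S T : I → I → I) (N : I → I) →
    IsTConorm S → IsTNorm T → IsStrongNegation N →
    (∀ x y → N (T x y) ≡ S (N x) (N y)) →
    ∀ x y z → I[ S , N , T ] x (I[ S , N , T ] y z) ≡ I[ S , N , T ] y (I[ S , N , T ] x z)
proposition3p4 R S T N isTConorm _ isStrongNegation deMorgan =
  I[S,N,T]-exchange R isTConorm isStrongNegation deMorgan
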